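{- Suppose $4\leq s\leq n$, $4\leq k\leq m$, $ms=nk$ and $s\equiv k\equiv 0\pmod 4$. Then there exists a shiftable integer $\mathcal{H}_t(m,n;s,k)$ for every divisor $t$ of $2ms$.
   Context: A partially filled (p.f.) array is an array in which some cells are filled and the others are empty. Let $v=2ms+t$ where $t$ divides $2ms$, and let $J$ be the subgroup of order $t$ of $\mathbb{Z}_v$. A Heffter array $\mathcal{H}_t(m,n;s,k)$ over $\mathbb{Z}_v$ relative to $J$ is an $m\times n$ p.f. array with elements in $\mathbb{Z}_v$ such that: (a) each row contains exactly $s$ filled cells and each column exactly $k$ filled cells; (b) for every $x\in\mathbb{Z}_v\setminus J$, either $x$ or $-x$ appears in the array; (c) the elements in every row and column sum to $0$. It is integer if the elements of every row and every column, viewed as integers in $\pm\{1,\ldots,\lfloor v/2\rfloor\}$, sum to $0$ in $\mathbb{Z}$ (so an integer Heffter array is regarded as a p.f. array with entries in $\mathbb{Z}$). A p.f. array with entries in $\mathbb{Z}$ is shiftable if every row and every column contains an equal number of positive and negative entries. -}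

module Defs where

open import Data.Nat as ℕ using (ℕ; zero; suc; _≤_; _<_)
open import Data.Nat.Divisibility as ℕD using ()
open import Data.Integer as ℤ using (ℤ; +_; _-_; -_)
open import Data.Integer.Divisibility as ℤD using ()
open import Data.Fin using (Fin)
open import Data.Maybe using (Maybe; just; nothing)
open import Data.Product using (Σ; _×_; ∃; ∃-syntax)
open import Data.Sum using (_⊎_)
open import Relation.Nullary using (¬_; does)
open import Relation.Binary.PropositionalEquality using (_≡_)
open import Data.Bool using (if_then_else_)

-- A partially filled m × n array with integer entries: nothing = empty cell.
PFArray : ℕ → ℕ → Set
PFArray m n = Fin m → Fin n → Maybe ℤ

sumℕ : (n : ℕ) → (Fin n → ℕ) → ℕ
sumℕ zero    f = 0
sumℕ (suc n) f = f Fin.zero ℕ.+ sumℕ n (λ i → f (Fin.suc i))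
  where import Data.Fin as Fin

sumℤ : (n : ℕ) → (Fin n → ℤ) → ℤ
sumℤ zero    f = + 0
sumℤ (suc n) f = f Fin.zero ℤ.+ sumℤ n (λ i → f (Fin.suc i))
  where import Data.Fin as Fin

val : Maybe ℤ → ℤ
val nothing  = + 0
val (just a) = a

isFilled : Maybe ℤ → ℕ
isFilled nothing  = 0
isFilled (just _) = 1

isPos : Maybe ℤ → ℕ
isPos nothing  = 0
isPos (just a) = if does (+ 1 ℤ.≤? a) then 1 else 0

isNeg : Maybe ℤ → ℕ
isNeg nothing  = 0
isNeg (just a) = if does (a ℤ.≤? - (+ 1)) then 1 else 0

-- Integer Heffter array H_t(m,n;s,k) over ℤ_v, v = 2ms + t, relative to the
-- subgroup J of order t of ℤ_v (J = {x : v ∣ x·t}).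
record IntegerHeffter (m n s k t : ℕ) (A : PFArray m n) : Set where
  field
    rowFill : ∀ i → sumℕ n (λ j → isFilled (A i j)) ≡ s
    colFill : ∀ j → sumℕ m (λ i → isFilled (A i j)) ≡ k
    entryRange : ∀ i j a → A i j ≡ just a →
                 1 ≤ ℤ.∣ a ∣ × ℤ.∣ a ∣ ≤ (2 ℕ.* m ℕ.* s ℕ.+ t) ℕ./ 2
    -- (b) every x ∈ ℤ_v ∖ J appears up to sign (congruence mod v)
    covers : ∀ x → x < 2 ℕ.* m ℕ.* s ℕ.+ t →
             ¬ ((2 ℕ.* m ℕ.* s ℕ.+ t) ℕD.∣ x ℕ.* t) →
             ∃[ i ] ∃[ j ] ∃[ a ] (A i j ≡ just a ×
               ((+ (2 ℕ.* m ℕ.* s ℕ.+ t) ℤD.∣ a - + x) ⊎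
                (+ (2 ℕ.* m ℕ.* s ℕ.+ t) ℤD.∣ a - - (+ x))))
    rowSum : ∀ i → sumℤ n (λ j → val (A i j)) ≡ + 0
    colSum : ∀ j → sumℤ m (λ i → val (A i j)) ≡ + 0

record Shiftable (m n : ℕ) (A : PFArray m n) : Set where
  field
    rowBal : ∀ i → sumℕ n (λ j → isPos (A i j)) ≡ sumℕ n (λ j → isNeg (A i j))
    colBal : ∀ j → sumℕ m (λ i → isPos (A i j)) ≡ sumℕ m (λ i → isNeg (A i j))

-- Let c = gcd(s, k) = 4q; then s = bc, k = ac, m = da, n = db and c ≤ d.  View the array
-- as d × d blocks of size a × b and fill block (I, J) when J − I mod d < c: a cyclic band of
-- c block diagonals, giving s filled cells in every row and k in every column.  The band is
-- cut into quadruples of diagonals 4g, …, 4g + 3 whose cells carry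
--     + (1 + B₀),   − (1 + B₁ + α),   − (1 + B₂ + β),   + (1 + B₃ + α + β),
-- where Bₗ = base w for a label w that sees the block (I, J) only through I + (l mod 2).
-- Along a row this gives B₀ = B₂ and B₁ = B₃, along a column B₀ = B₁ and B₂ = B₃; either
-- way B₀ + B₃ = B₁ + B₂, so all row and column sums vanish in ℤ and the signs are balanced.
-- With 2ms = Rt and V = 2ms + t = (R + 1)t, the elements of ℤ_V outside the subgroup of
-- order t are those not divisible by R + 1.  The labelling base, chosen according to how
-- the factor 8 of Rt = 8 · (ms/4) splits between R and t, makes the magnitudes cover every
-- y ≤ V/2 with R + 1 ∤ y, which gives condition (b).

module Submission where

open import Defs
open import Data.Fin as Fin using (Fin; toℕ; fromℕ<)
open import Data.Fin.Properties using (toℕ<n; toℕ-fromℕ<)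
open import Data.Integer as ℤ using (ℤ; +_)
import Data.Integer.Properties as ℤ
open import Data.Integer.Divisibility using () renaming (_∣_ to _∣ℤ_)
open import Data.Integer.Tactic.RingSolver using () renaming (solve-∀ to ℤ-solve-∀)
open import Data.Maybe using (Maybe; just; nothing)
open import Data.Maybe.Properties using (just-injective)
open import Data.Nat using (ℕ; zero; suc; _≤_; _<_; _*_; _%_; z≤n; s≤s; _+_; _∸_; _/_; _^_; _<?_; _≤?_; NonZero; ≢-nonZero; >-nonZero; >-nonZero⁻¹)
open import Data.Nat.Coprimality as Coprime using (Coprime; coprime-divisor; coprime-/gcd)
open import Data.Nat.Divisibility using (_∣_; divides; m%n≡0⇒n∣m; _∣0; ∣-refl; ∣m+n∣m⇒∣n)
open import Data.Nat.DivMod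
open import Data.Nat.GCD using (gcd; gcd-greatest; gcd[m,n]∣m; gcd[m,n]∣n; gcd[m,n]≢0)
open import Data.Nat.Primality using (euclidsLemma; prime[2])
open import Data.Nat.Properties
open import Data.Nat.Tactic.RingSolver using (solve-∀)
open import Data.Product using (∃-syntax; _×_; _,_; proj₁; proj₂)
open import Data.Sum using (_⊎_; inj₁; inj₂)
open import Function using (_∘_)
open import Relation.Binary.PropositionalEquality hiding (J)
open import Relation.Nullary using (yes; no; ¬_)
open import Relation.Nullary.Negation using (contradiction)

∑ : ℕ → (ℕ → ℤ) → ℤ
∑ zero    f = + 0
∑ (suc n) f = f 0 ℤ.+ ∑ n (f ∘ suc)

∑-cong : ∀ n {f g : ℕ → ℤ} → (∀ i → i < n → f i ≡ g i) → ∑ n f ≡ ∑ n g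
∑-cong zero    f≡g = refl
∑-cong (suc n) f≡g = cong₂ ℤ._+_ (f≡g 0 (s≤s z≤n)) (∑-cong n (λ i i<n → f≡g (suc i) (s≤s i<n)))

∑-const : ∀ n k → ∑ n (λ _ → + k) ≡ + (n * k)
∑-const zero    k = refl
∑-const (suc n) k = cong (ℤ._+_ (+ k)) (∑-const n k)

∑-zero : ∀ n (f : ℕ → ℤ) → (∀ i → i < n → f i ≡ + 0) → ∑ n f ≡ + 0
∑-zero n f f≡0 = trans (∑-cong n f≡0) (trans (∑-const n 0) (cong +_ (*-zeroʳ n)))

∑-+ : ∀ m n (f : ℕ → ℤ) → ∑ (m + n) f ≡ ∑ m f ℤ.+ ∑ n (λ i → f (m + i))
∑-+ zero    n f = sym (ℤ.+-identityˡ _)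
∑-+ (suc m) n f = trans (cong (ℤ._+_ (f 0)) (∑-+ m n (f ∘ suc))) (sym (ℤ.+-assoc (f 0) _ _))

∑-distrib : ∀ n (f g : ℕ → ℤ) → ∑ n (λ i → f i ℤ.+ g i) ≡ ∑ n f ℤ.+ ∑ n g
∑-distrib zero    f g = refl
∑-distrib (suc n) f g = begin
  (f 0 ℤ.+ g 0) ℤ.+ ∑ n (λ i → f (suc i) ℤ.+ g (suc i))
    ≡⟨ cong (ℤ._+_ (f 0 ℤ.+ g 0)) (∑-distrib n (f ∘ suc) (g ∘ suc)) ⟩
  (f 0 ℤ.+ g 0) ℤ.+ (∑ n (f ∘ suc) ℤ.+ ∑ n (g ∘ suc))
    ≡⟨ ℤ.+-assoc (f 0) (g 0) _ ⟩
  f 0 ℤ.+ (g 0 ℤ.+ (∑ n (f ∘ suc) ℤ.+ ∑ n (g ∘ suc)))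
    ≡⟨ cong (ℤ._+_ (f 0)) (ℤ.+-comm (g 0) _) ⟩
  f 0 ℤ.+ ((∑ n (f ∘ suc) ℤ.+ ∑ n (g ∘ suc)) ℤ.+ g 0)
    ≡⟨ cong (ℤ._+_ (f 0)) (ℤ.+-assoc (∑ n (f ∘ suc)) _ _) ⟩
  f 0 ℤ.+ (∑ n (f ∘ suc) ℤ.+ (∑ n (g ∘ suc) ℤ.+ g 0))
    ≡⟨ cong (λ x → f 0 ℤ.+ (∑ n (f ∘ suc) ℤ.+ x)) (ℤ.+-comm _ (g 0)) ⟩
  f 0 ℤ.+ (∑ n (f ∘ suc) ℤ.+ ∑ (suc n) g)
    ≡⟨ ℤ.+-assoc (f 0) _ _ ⟨
  ∑ (suc n) f ℤ.+ ∑ (suc n) g ∎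
  where open ≡-Reasoning

∑-* : ∀ m n (f : ℕ → ℤ) → ∑ (m * n) f ≡ ∑ m (λ i → ∑ n (λ j → f (i * n + j)))
∑-* zero    n f = refl
∑-* (suc m) n f = trans (∑-+ n (m * n) f) (cong (ℤ._+_ (∑ n f))
  (trans (∑-* m n (λ i → f (n + i)))
         (∑-cong m (λ i _ → ∑-cong n (λ j _ → cong f (sym (+-assoc n (i * n) j)))))))

∑-comm : ∀ m n (f : ℕ → ℕ → ℤ) → ∑ m (λ i → ∑ n (f i)) ≡ ∑ n (λ j → ∑ m (λ i → f i j))
∑-comm zero    n f = sym (∑-zero n _ (λ _ _ → refl))
∑-comm (suc m) n f = trans (cong (ℤ._+_ (∑ n (f 0))) (∑-comm m n (f ∘ suc)))
                           (sym (∑-distrib n (f 0) (λ j → ∑ m (λ i → f (suc i) j))))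

∑-reverse : ∀ n (f : ℕ → ℤ) → ∑ n f ≡ ∑ n (λ i → f (n ∸ suc i))
∑-reverse zero    f = refl
∑-reverse (suc n) f = begin
  ∑ (suc n) f                      ≡⟨ cong (λ k → ∑ k f) (+-comm 1 n) ⟩
  ∑ (n + 1) f                      ≡⟨ ∑-+ n 1 f ⟩
  ∑ n f ℤ.+ (f (n + 0) ℤ.+ + 0)    ≡⟨ cong (ℤ._+_ (∑ n f)) (trans (ℤ.+-identityʳ _) (cong f (+-identityʳ n))) ⟩
  ∑ n f ℤ.+ f n                    ≡⟨ ℤ.+-comm (∑ n f) (f n) ⟩
  f n ℤ.+ ∑ n f                    ≡⟨ cong (ℤ._+_ (f n)) (∑-reverse n f) ⟩
  ∑ (suc n) (λ i → f (suc n ∸ suc i)) ∎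
  where open ≡-Reasoning

∑-prefix : ∀ {c d} (f : ℕ → ℤ) → c ≤ d → (∀ L → c ≤ L → L < d → f L ≡ + 0) → ∑ d f ≡ ∑ c f
∑-prefix {c} {d} f c≤d vanishes = begin
  ∑ d f                                   ≡⟨ cong (λ n → ∑ n f) (m+[n∸m]≡n c≤d) ⟨
  ∑ (c + (d ∸ c)) f                       ≡⟨ ∑-+ c (d ∸ c) f ⟩
  ∑ c f ℤ.+ ∑ (d ∸ c) (λ i → f (c + i))   ≡⟨ cong (ℤ._+_ (∑ c f)) (∑-zero (d ∸ c) _ (λ i i<d∸c →
                                               vanishes (c + i) (m≤m+n c i) (subst (c + i <_) (m+[n∸m]≡n c≤d) (+-monoʳ-< c i<d∸c)))) ⟩
  ∑ c f ℤ.+ + 0                           ≡⟨ ℤ.+-identityʳ (∑ c f) ⟩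
  ∑ c f                                   ∎
  where open ≡-Reasoning

sumℤ≡∑ : ∀ n (f : ℕ → ℤ) → sumℤ n (λ j → f (toℕ j)) ≡ ∑ n f
sumℤ≡∑ zero    f = refl
sumℤ≡∑ (suc n) f = cong (ℤ._+_ (f 0)) (sumℤ≡∑ n (f ∘ suc))

sumℕ≡sumℤ : ∀ n (f : Fin n → ℕ) → + sumℕ n f ≡ sumℤ n (λ j → + f j)
sumℕ≡sumℤ zero    f = refl
sumℕ≡sumℤ (suc n) f = trans (ℤ.pos-+ (f Fin.zero) _) (cong (ℤ._+_ (+ f Fin.zero)) (sumℕ≡sumℤ n (f ∘ Fin.suc)))

[m*n+o]/n≡m : ∀ m {n o} .{{_ : NonZero n}} → o < n → (m * n + o) / n ≡ m
[m*n+o]/n≡m m {n} {o} o<n = begin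
  (m * n + o) / n      ≡⟨ +-distrib-/-∣ˡ o (divides m refl) ⟩
  m * n / n + o / n    ≡⟨ cong₂ _+_ (m*n/n≡m m n) (m<n⇒m/n≡0 o<n) ⟩
  m + 0                ≡⟨ +-identityʳ m ⟩
  m                    ∎
  where open ≡-Reasoning

[m*n+o]%n≡o : ∀ m {n o} .{{_ : NonZero n}} → o < n → (m * n + o) % n ≡ o
[m*n+o]%n≡o m {n} {o} o<n = begin
  (m * n + o) % n  ≡⟨ cong (_% n) (+-comm (m * n) o) ⟩
  (o + m * n) % n  ≡⟨ [m+kn]%n≡m%n o m n ⟩
  o % n            ≡⟨ m<n⇒m%n≡m o<n ⟩
  o                ∎
  where open ≡-Reasoning

[m/n]*n+m%n≡m : ∀ m n .{{_ : NonZero n}} → m / n * n + m % n ≡ m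
[m/n]*n+m%n≡m m n = trans (+-comm (m / n * n) (m % n)) (sym (m≡m%n+[m/n]*n m n))

m*n+o<p*n : ∀ {m n o p} → m < p → o < n → m * n + o < p * n
m*n+o<p*n {m} {n} {o} {p} m<p o<n = begin-strict
  m * n + o  <⟨ +-monoʳ-< (m * n) o<n ⟩
  m * n + n  ≡⟨ +-comm (m * n) n ⟩
  suc m * n  ≤⟨ *-monoˡ-≤ n m<p ⟩
  p * n      ∎
  where open ≤-Reasoning

∑-div-mod : ∀ m n .{{_ : NonZero n}} (f : ℕ → ℕ → ℤ) →
            ∑ (m * n) (λ i → f (i / n) (i % n)) ≡ ∑ m (λ i → ∑ n (f i))
∑-div-mod m n f = trans (∑-* m n _) (∑-cong m (λ i _ → ∑-cong n (λ j j<n →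
  cong₂ f ([m*n+o]/n≡m i j<n) ([m*n+o]%n≡o i j<n))))

m≤n/2 : ∀ {m n} → 2 * m ≤ n → m ≤ n / 2
m≤n/2 {m} {n} 2m≤n = subst (_≤ n / 2) (trans (cong (_/ 2) (*-comm 2 m)) (m*n/n≡m m 2)) (/-monoˡ-≤ 2 2m≤n)

x*[y*z]≡y*[x*z] : ∀ x y z → x * (y * z) ≡ y * (x * z)
x*[y*z]≡y*[x*z] = solve-∀

nonZero-factor : ∀ x {y z} → 0 < z → z ≡ x * y → NonZero x
nonZero-factor zero    0<z refl = contradiction 0<z (<-irrefl refl)
nonZero-factor (suc x) _   _    = _

[1+n]∤[1+m]⇒m%[1+n]<n : ∀ {n m} → ¬ suc n ∣ suc m → m % suc n < n
[1+n]∤[1+m]⇒m%[1+n]<n {n} {m} ¬[1+n]∣[1+m] with m≤n⇒m<n∨m≡n (<⇒≤pred (m%n<n m (suc n)))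
... | inj₁ m%[1+n]<n = m%[1+n]<n
... | inj₂ m%[1+n]≡n = contradiction (divides (suc (m / suc n)) (cong suc (begin
  m                              ≡⟨ m≡m%n+[m/n]*n m (suc n) ⟩
  m % suc n + m / suc n * suc n  ≡⟨ cong (_+ m / suc n * suc n) m%[1+n]≡n ⟩
  n + m / suc n * suc n          ∎))) ¬[1+n]∣[1+m]
  where open ≡-Reasoning

reflect-to-lower-half : ∀ {V x} → x < V → ∃[ y ] (2 * y ≤ V × (y ≡ x ⊎ x + y ≡ V))
reflect-to-lower-half {V} {x} x<V with 2 * x ≤? V
... | yes 2x≤V = x , 2x≤V , inj₁ refl
... | no 2x≰V = V ∸ x , 2[V∸x]≤V , inj₂ (m+[n∸m]≡n (<⇒≤ x<V))
  where
  2[V∸x]≤V : 2 * (V ∸ x) ≤ V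
  2[V∸x]≤V = begin
    2 * (V ∸ x)      ≡⟨ *-distribˡ-∸ 2 V x ⟩
    2 * V ∸ 2 * x    ≤⟨ m≤n+o⇒m∸n≤o (2 * V) (2 * x) 2V≤2x+V ⟩
    V                ∎
    where
    open ≤-Reasoning
    2V≤2x+V : 2 * V ≤ 2 * x + V
    2V≤2x+V = subst (_≤ 2 * x + V) (cong (_+_ V) (sym (+-identityʳ V))) (+-monoˡ-≤ V (<⇒≤ (≰⇒> 2x≰V)))

module Cyclic (d : ℕ) .{{_ : NonZero d}} where

  infixl 6 _⊕_ _⊖_

  _⊕_ : ℕ → ℕ → ℕ
  I ⊕ L = (I + L) % d

  _⊖_ : ℕ → ℕ → ℕ
  J ⊖ L = (J + (d ∸ L)) % d

  ⊕<d : ∀ I L → I ⊕ L < d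
  ⊕<d I L = m%n<n (I + L) d

  ⊖<d : ∀ J L → J ⊖ L < d
  ⊖<d J L = m%n<n (J + (d ∸ L)) d

  [m%d+n]%d≡[m+n]%d : ∀ m n → (m % d + n) % d ≡ (m + n) % d
  [m%d+n]%d≡[m+n]%d m n = begin
    (m % d + n) % d          ≡⟨ %-distribˡ-+ (m % d) n d ⟩
    (m % d % d + n % d) % d  ≡⟨ cong (λ x → (x + n % d) % d) (m%n%n≡m%n m d) ⟩
    (m % d + n % d) % d      ≡⟨ %-distribˡ-+ m n d ⟨
    (m + n) % d              ∎
    where open ≡-Reasoning

  [m+n%d]%d≡[m+n]%d : ∀ m n → (m + n % d) % d ≡ (m + n) % d
  [m+n%d]%d≡[m+n]%d m n = begin
    (m + n % d) % d  ≡⟨ cong (_% d) (+-comm m (n % d)) ⟩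
    (n % d + m) % d  ≡⟨ [m%d+n]%d≡[m+n]%d n m ⟩
    (n + m) % d      ≡⟨ cong (_% d) (+-comm n m) ⟩
    (m + n) % d      ∎
    where open ≡-Reasoning

  [m+d]%d≡m : ∀ {m} → m < d → (m + d) % d ≡ m
  [m+d]%d≡m {m} m<d = trans ([m+n]%n≡m%n m d) (m<n⇒m%n≡m m<d)

  ⊕-comm : ∀ I L → I ⊕ L ≡ L ⊕ I
  ⊕-comm I L = cong (_% d) (+-comm I L)

  ⊕-assoc : ∀ I J K → (I ⊕ J) ⊕ K ≡ I ⊕ (J ⊕ K)
  ⊕-assoc I J K = begin
    ((I + J) % d + K) % d  ≡⟨ [m%d+n]%d≡[m+n]%d (I + J) K ⟩
    (I + J + K) % d        ≡⟨ cong (_% d) (+-assoc I J K) ⟩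
    (I + (J + K)) % d      ≡⟨ [m+n%d]%d≡[m+n]%d I (J + K) ⟨
    (I + (J + K) % d) % d  ∎
    where open ≡-Reasoning

  ⊕-≡-+ : ∀ I L → I + L < d → I ⊕ L ≡ I + L
  ⊕-≡-+ I L = m<n⇒m%n≡m

  ⊕-identityʳ : ∀ {I} → I < d → I ⊕ 0 ≡ I
  ⊕-identityʳ {I} I<d = trans (cong (_% d) (+-identityʳ I)) (m<n⇒m%n≡m I<d)

  ⊖-⊕ : ∀ {J L} → J < d → L ≤ d → (J ⊖ L) ⊕ L ≡ J
  ⊖-⊕ {J} {L} J<d L≤d = begin
    ((J + (d ∸ L)) % d + L) % d  ≡⟨ [m%d+n]%d≡[m+n]%d (J + (d ∸ L)) L ⟩
    (J + (d ∸ L) + L) % d        ≡⟨ cong (_% d) (trans (+-assoc J (d ∸ L) L) (cong (_+_ J) (m∸n+n≡m L≤d))) ⟩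
    (J + d) % d                  ≡⟨ [m+d]%d≡m J<d ⟩
    J                            ∎
    where open ≡-Reasoning

  ⊕-⊖ : ∀ {I L} → I < d → L ≤ d → (I ⊕ L) ⊖ L ≡ I
  ⊕-⊖ {I} {L} I<d L≤d = begin
    ((I + L) % d + (d ∸ L)) % d  ≡⟨ [m%d+n]%d≡[m+n]%d (I + L) (d ∸ L) ⟩
    (I + L + (d ∸ L)) % d        ≡⟨ cong (_% d) (trans (+-assoc I L (d ∸ L)) (cong (_+_ I) (m+[n∸m]≡n L≤d))) ⟩
    (I + d) % d                  ≡⟨ [m+d]%d≡m I<d ⟩
    I                            ∎
    where open ≡-Reasoning

  [I⊕L]⊖I≡L : ∀ {I L} → I < d → L < d → (I ⊕ L) ⊖ I ≡ L
  [I⊕L]⊖I≡L {I} {L} I<d L<d = trans (cong (_⊖ I) (⊕-comm I L)) (⊕-⊖ L<d (<⇒≤ I<d))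

  ⊖-involutive : ∀ {J L} → J < d → L < d → J ⊖ (J ⊖ L) ≡ L
  ⊖-involutive {J} {L} J<d L<d = begin
    J ⊖ (J ⊖ L)                ≡⟨ cong (_⊖ (J ⊖ L)) (⊖-⊕ J<d (<⇒≤ L<d)) ⟨
    ((J ⊖ L) ⊕ L) ⊖ (J ⊖ L)    ≡⟨ cong (_⊖ (J ⊖ L)) (⊕-comm (J ⊖ L) L) ⟩
    (L ⊕ (J ⊖ L)) ⊖ (J ⊖ L)    ≡⟨ ⊕-⊖ L<d (<⇒≤ (⊖<d J L)) ⟩
    L                          ∎
    where open ≡-Reasoning

  ⊖-suc : ∀ {J L} → J < d → suc L < d → (J ⊖ suc L) ⊕ 1 ≡ J ⊖ L
  ⊖-suc {J} {L} J<d 1+L<d = begin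
    Z ⊕ 1                  ≡⟨ ⊕-⊖ (⊕<d Z 1) (<⇒≤ (<-trans (n<1+n L) 1+L<d)) ⟨
    (Z ⊕ 1) ⊕ L ⊖ L        ≡⟨ cong (_⊖ L) (⊕-assoc Z 1 L) ⟩
    Z ⊕ (1 ⊕ L) ⊖ L        ≡⟨ cong (λ x → Z ⊕ x ⊖ L) (⊕-≡-+ 1 L 1+L<d) ⟩
    Z ⊕ suc L ⊖ L          ≡⟨ cong (_⊖ L) (⊖-⊕ J<d (<⇒≤ 1+L<d)) ⟩
    J ⊖ L                  ∎
    where
    open ≡-Reasoning
    Z : ℕ
    Z = J ⊖ suc L

  ∑-rotate : ∀ (f : ℕ → ℤ) {I} → I < d → ∑ d f ≡ ∑ d (λ L → f (I ⊕ L))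
  ∑-rotate f {I} I<d = begin
    ∑ d f                                                ≡⟨ cong (λ n → ∑ n f) (m+[n∸m]≡n (<⇒≤ I<d)) ⟨
    ∑ (I + K) f                                          ≡⟨ ∑-+ I K f ⟩
    ∑ I f ℤ.+ ∑ K (λ L → f (I + L))                      ≡⟨ ℤ.+-comm (∑ I f) _ ⟩
    ∑ K (λ L → f (I + L)) ℤ.+ ∑ I f                      ≡⟨ cong₂ ℤ._+_ (∑-cong K (λ L L<K → cong f (sym (⊕-≡-+ I L (below L L<K)))))
                                                                       (∑-cong I (λ i i<I → cong f (sym (wrap i<I)))) ⟩
    ∑ K (λ L → f (I ⊕ L)) ℤ.+ ∑ I (λ i → f (I ⊕ (K + i))) ≡⟨ ∑-+ K I (λ L → f (I ⊕ L)) ⟨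
    ∑ (K + I) (λ L → f (I ⊕ L))                          ≡⟨ cong (λ n → ∑ n (λ L → f (I ⊕ L))) (m∸n+n≡m (<⇒≤ I<d)) ⟩
    ∑ d (λ L → f (I ⊕ L))                                ∎
    where
    open ≡-Reasoning
    K : ℕ
    K = d ∸ I
    below : ∀ L → L < K → I + L < d
    below L L<K = subst (I + L <_) (m+[n∸m]≡n (<⇒≤ I<d)) (+-monoʳ-< I L<K)
    wrap : ∀ {i} → i < I → I ⊕ (K + i) ≡ i
    wrap {i} i<I = begin
      (I + (K + i)) % d  ≡⟨ cong (_% d) (trans (sym (+-assoc I K i)) (trans (cong (_+ i) (m+[n∸m]≡n (<⇒≤ I<d))) (+-comm d i))) ⟩
      (i + d) % d        ≡⟨ [m+d]%d≡m (<-trans i<I I<d) ⟩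
      i                  ∎

  ∑-reflect : ∀ (f : ℕ → ℤ) {J} → J < d → ∑ d f ≡ ∑ d (λ L → f (J ⊖ L))
  ∑-reflect f {J} J<d = begin
    ∑ d f                                  ≡⟨ ∑-rotate f (⊕<d J 1) ⟩
    ∑ d (λ L → f (J ⊕ 1 ⊕ L))              ≡⟨ ∑-reverse d _ ⟩
    ∑ d (λ L → f (J ⊕ 1 ⊕ (d ∸ suc L)))    ≡⟨ ∑-cong d (λ L L<d → cong f (reflection L<d)) ⟩
    ∑ d (λ L → f (J ⊖ L))                  ∎
    where
    open ≡-Reasoning
    reflection : ∀ {L} → L < d → J ⊕ 1 ⊕ (d ∸ suc L) ≡ J ⊖ L
    reflection {L} L<d = begin
      ((J + 1) % d + (d ∸ suc L)) % d  ≡⟨ [m%d+n]%d≡[m+n]%d (J + 1) (d ∸ suc L) ⟩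
      (J + 1 + (d ∸ suc L)) % d        ≡⟨ cong (_% d) (trans (+-assoc J 1 _) (cong (_+_ J) (sym (+-∸-assoc 1 L<d)))) ⟩
      (J + (d ∸ L)) % d                ∎

signed : ℕ → ℕ → ℤ
signed 1 n = ℤ.- + n
signed 2 n = ℤ.- + n
signed _ n = + n

offset : ℕ → ℕ → ℕ → ℕ
offset α β l = l % 2 * α + l / 2 * β

∣signed∣ : ∀ l n → ℤ.∣ signed l n ∣ ≡ n
∣signed∣ 0 n = refl
∣signed∣ 1 n = ℤ.∣-i∣≡∣i∣ (+ n)
∣signed∣ 2 n = ℤ.∣-i∣≡∣i∣ (+ n)
∣signed∣ (suc (suc (suc l))) n = refl

signed-± : ∀ l n → signed l n ≡ + n ⊎ signed l n ≡ ℤ.- + n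
signed-± 0 n = inj₁ refl
signed-± 1 n = inj₂ refl
signed-± 2 n = inj₂ refl
signed-± (suc (suc (suc l))) n = inj₁ refl

offset-1-2 : ∀ l → offset 1 2 l ≡ l
offset-1-2 l = begin
  l % 2 * 1 + l / 2 * 2  ≡⟨ cong (_+ l / 2 * 2) (*-identityʳ (l % 2)) ⟩
  l % 2 + l / 2 * 2      ≡⟨ m≡m%n+[m/n]*n l 2 ⟨
  l                      ∎
  where open ≡-Reasoning

quadruple-sum : ∀ (B : ℕ → ℕ) α β → B 0 + B 3 ≡ B 1 + B 2 →
                ∑ 4 (λ l → signed l (suc (B l + offset α β l))) ≡ + 0
quadruple-sum B α β balanced = begin
  + P ℤ.+ (ℤ.- + Q ℤ.+ (ℤ.- + S ℤ.+ (+ T ℤ.+ + 0)))  ≡⟨ rearrange (+ P) (+ Q) (+ S) (+ T) ⟩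
  (+ P ℤ.+ + T) ℤ.- (+ Q ℤ.+ + S)                   ≡⟨ cong₂ ℤ._-_ (ℤ.pos-+ P T) (ℤ.pos-+ Q S) ⟨
  + (P + T) ℤ.- + (Q + S)                           ≡⟨ cong (λ x → + x ℤ.- + (Q + S)) magnitudes ⟩
  + (Q + S) ℤ.- + (Q + S)                           ≡⟨ ℤ.+-inverseʳ (+ (Q + S)) ⟩
  + 0                                               ∎
  where
  open ≡-Reasoning
  P : ℕ
  P = suc (B 0 + offset α β 0)
  Q : ℕ
  Q = suc (B 1 + offset α β 1)
  S : ℕ
  S = suc (B 2 + offset α β 2)
  T : ℕ
  T = suc (B 3 + offset α β 3)
  rearrange : ∀ p q s t → p ℤ.+ (ℤ.- q ℤ.+ (ℤ.- s ℤ.+ (t ℤ.+ + 0))) ≡ (p ℤ.+ t) ℤ.- (q ℤ.+ s)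
  rearrange = ℤ-solve-∀
  magnitudes : P + T ≡ Q + S
  magnitudes = begin
    P + T                             ≡⟨ lhs (B 0) (B 3) α β ⟩
    (B 0 + B 3) + (2 + α + β)         ≡⟨ cong (_+ (2 + α + β)) balanced ⟩
    (B 1 + B 2) + (2 + α + β)         ≡⟨ rhs (B 1) (B 2) α β ⟨
    Q + S                             ∎
    where
    lhs : ∀ x y α β → suc (x + 0) + suc (y + (1 * α + 1 * β)) ≡ (x + y) + (2 + α + β)
    lhs = solve-∀
    rhs : ∀ x y α β → suc (x + (1 * α + 0 * β)) + suc (y + (0 * α + 1 * β)) ≡ (x + y) + (2 + α + β)
    rhs = solve-∀

common-multiple : ∀ {m n a b} .{{_ : NonZero a}} → Coprime a b → m * b ≡ n * a → ∃[ d ] (m ≡ d * a × n ≡ d * b)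
common-multiple {m} {n} {a} {b} a⊥b m*b≡n*a with coprime-divisor a⊥b (divides n (trans (*-comm b m) m*b≡n*a))
... | divides d m≡d*a = d , m≡d*a , *-cancelʳ-≡ n (d * b) a (begin
  n * a        ≡⟨ m*b≡n*a ⟨
  m * b        ≡⟨ cong (_* b) m≡d*a ⟩
  d * a * b    ≡⟨ *-assoc d a b ⟩
  d * (a * b)  ≡⟨ cong (d *_) (*-comm a b) ⟩
  d * (b * a)  ≡⟨ *-assoc d b a ⟨
  d * b * a    ∎)
  where open ≡-Reasoning

record Factorisation (m n s k : ℕ) : Set where
  field
    a b q d : ℕ
    {{a≢0}} : NonZero a
    {{b≢0}} : NonZero b
    {{q≢0}} : NonZero q
    {{d≢0}} : NonZero d
    m≡d*a : m ≡ d * a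
    n≡d*b : n ≡ d * b
    s≡b*c : s ≡ b * (q * 4)
    k≡a*c : k ≡ a * (q * 4)
    c≤d   : q * 4 ≤ d

factorise : ∀ {m n s k} → 4 ≤ s → s ≤ n → 4 ≤ k → m * s ≡ n * k → 4 ∣ s → 4 ∣ k →
            Factorisation m n s k
factorise {m} {n} {s} {k} 4≤s s≤n 4≤k ms≡nk 4∣s 4∣k
  with gcd-greatest 4∣s 4∣k
... | divides q g≡q*4 = record
  { a = a ; b = b ; q = q ; d = d
  ; m≡d*a = m≡d*a ; n≡d*b = n≡d*b ; s≡b*c = s≡b*c ; k≡a*c = k≡a*c ; c≤d = c≤d }
  where
  g : ℕ
  g = gcd s k
  instance
    g≢0 : NonZero g
    g≢0 = ≢-nonZero (gcd[m,n]≢0 s k (inj₁ (λ s≡0 → <⇒≱ (subst (3 <_) s≡0 4≤s) z≤n)))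
  a : ℕ
  a = k / g
  b : ℕ
  b = s / g
  s≡b*g : s ≡ b * g
  s≡b*g = sym (m/n*n≡m (gcd[m,n]∣m s k))
  k≡a*g : k ≡ a * g
  k≡a*g = sym (m/n*n≡m (gcd[m,n]∣n s k))
  s≡b*c : s ≡ b * (q * 4)
  s≡b*c = trans s≡b*g (cong (b *_) g≡q*4)
  k≡a*c : k ≡ a * (q * 4)
  k≡a*c = trans k≡a*g (cong (a *_) g≡q*4)
  instance
    a≢0 : NonZero a
    a≢0 = nonZero-factor a (≤-trans (s≤s z≤n) 4≤k) k≡a*g
    b≢0 : NonZero b
    b≢0 = nonZero-factor b (≤-trans (s≤s z≤n) 4≤s) s≡b*g
    q≢0 : NonZero q
    q≢0 = nonZero-factor q (>-nonZero⁻¹ g) g≡q*4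
  m*b≡n*a : m * b ≡ n * a
  m*b≡n*a = *-cancelʳ-≡ (m * b) (n * a) g (begin
    m * b * g    ≡⟨ *-assoc m b g ⟩
    m * (b * g)  ≡⟨ cong (m *_) s≡b*g ⟨
    m * s        ≡⟨ ms≡nk ⟩
    n * k        ≡⟨ cong (n *_) k≡a*g ⟩
    n * (a * g)  ≡⟨ *-assoc n a g ⟨
    n * a * g    ∎)
    where open ≡-Reasoning
  multiple : ∃[ d ] (m ≡ d * a × n ≡ d * b)
  multiple = common-multiple (Coprime.sym (coprime-/gcd s k)) m*b≡n*a
  d : ℕ
  d = proj₁ multiple
  m≡d*a : m ≡ d * a
  m≡d*a = proj₁ (proj₂ multiple)
  n≡d*b : n ≡ d * b
  n≡d*b = proj₂ (proj₂ multiple)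
  c≤d : q * 4 ≤ d
  c≤d = *-cancelˡ-≤ b (subst₂ _≤_ s≡b*c (trans n≡d*b (*-comm d b)) s≤n)
  instance
    d≢0 : NonZero d
    d≢0 = >-nonZero (≤-trans (m≤n*m 1 q) (≤-trans (*-monoʳ-≤ q (s≤s z≤n)) c≤d))

-- For V = 8W + t = (R + 1)t: the 4W magnitudes 1 + base w + offset α β l lie in [1, V/2],
-- and every y = 1 + j (R + 1) + r with r < R and y ≤ V/2 is one of them.
record MagnitudeScheme (W R t : ℕ) : Set where
  field
    base   : ℕ → ℕ
    α β    : ℕ
    bounded : ∀ {w l} → w < W → l < 4 → 2 * suc (base w + offset α β l) ≤ W * 8 + t
    onto    : ∀ j {r} → r < R → 2 * (j * suc R + r) + 2 ≤ W * 8 + t →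
              ∃[ w ] ∃[ l ] (w < W × l < 4 × base w + offset α β l ≡ j * suc R + r)

module SchemeByQuarters (W Q t : ℕ) .{{_ : NonZero Q}} (Q*t≡2*W : Q * t ≡ 2 * W) where

  base : ℕ → ℕ
  base w = w * 4 + w / Q

  2[w/Q]<t : ∀ {w} → w < W → 2 * (w / Q) < t
  2[w/Q]<t {w} w<W = *-cancelʳ-< Q (2 * (w / Q)) t (begin-strict
    2 * (w / Q) * Q    ≡⟨ *-assoc 2 (w / Q) Q ⟩
    2 * (w / Q * Q)    ≤⟨ *-monoʳ-≤ 2 (m/n*n≤m w Q) ⟩
    2 * w              <⟨ *-monoʳ-< 2 w<W ⟩
    2 * W              ≡⟨ Q*t≡2*W ⟨
    Q * t              ≡⟨ *-comm Q t ⟩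
    t * Q              ∎)
    where open ≤-Reasoning

  bounded : ∀ {w l} → w < W → l < 4 → 2 * suc (base w + offset 1 2 l) ≤ W * 8 + t
  bounded {w} {l} w<W l<4 = begin
    2 * suc (w * 4 + w / Q + offset 1 2 l)  ≡⟨ cong (λ x → 2 * suc (w * 4 + w / Q + x)) (offset-1-2 l) ⟩
    2 * suc (w * 4 + w / Q + l)             ≡⟨ cong (2 *_) (reorder (w * 4) (w / Q) l) ⟩
    2 * (suc (w * 4 + l) + w / Q)           ≤⟨ *-monoʳ-≤ 2 (+-monoˡ-≤ (w / Q) (m*n+o<p*n w<W l<4)) ⟩
    2 * (W * 4 + w / Q)                     ≡⟨ distribute W (w / Q) ⟩
    W * 8 + 2 * (w / Q)                     ≤⟨ +-monoʳ-≤ (W * 8) (<⇒≤ (2[w/Q]<t w<W)) ⟩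
    W * 8 + t                               ∎
    where
    open ≤-Reasoning
    reorder : ∀ x y z → suc (x + y + z) ≡ suc (x + z) + y
    reorder = solve-∀
    distribute : ∀ x y → 2 * (x * 4 + y) ≡ x * 8 + 2 * y
    distribute = solve-∀

  onto : ∀ j {r} → r < Q * 4 → 2 * (j * suc (Q * 4) + r) + 2 ≤ W * 8 + t →
         ∃[ w ] ∃[ l ] (w < W × l < 4 × base w + offset 1 2 l ≡ j * suc (Q * 4) + r)
  onto j {r} r<R bound = w , l , w<W , m%n<n r 4 , hits
    where
    l : ℕ
    l = r % 4
    r/4<Q : r / 4 < Q
    r/4<Q = m<n*o⇒m/o<n r<R
    w : ℕ
    w = j * Q + r / 4
    hits′ : base w + offset 1 2 l ≡ w * 4 + j + l
    hits′ = cong₂ (λ x y → w * 4 + x + y) ([m*n+o]/n≡m j r/4<Q) (offset-1-2 l)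
    hits : base w + offset 1 2 l ≡ j * suc (Q * 4) + r
    hits = begin
      base w + offset 1 2 l          ≡⟨ hits′ ⟩
      (j * Q + r / 4) * 4 + j + l    ≡⟨ regroup j Q (r / 4) l ⟩
      j * suc (Q * 4) + (l + r / 4 * 4) ≡⟨ cong (_+_ (j * suc (Q * 4))) (m≡m%n+[m/n]*n r 4) ⟨
      j * suc (Q * 4) + r            ∎
      where
      open ≡-Reasoning
      regroup : ∀ j Q x l → (j * Q + x) * 4 + j + l ≡ j * suc (Q * 4) + (l + x * 4)
      regroup = solve-∀
    w<W : w < W
    w<W with w <? W
    ... | yes w<W = w<W
    ... | no w≮W = contradiction bound (<⇒≱ (begin-strict
      W * 8 + t                      ≤⟨ +-monoʳ-≤ (W * 8) (≤-pred t≤1+2j) ⟩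
      W * 8 + suc (2 * j)            <⟨ ≤-reflexive (regroup W j) ⟩
      2 * (W * 4 + j) + 2            ≤⟨ +-monoˡ-≤ 2 (*-monoʳ-≤ 2 (+-monoˡ-≤ j (*-monoˡ-≤ 4 W≤w))) ⟩
      2 * (w * 4 + j) + 2            ≤⟨ +-monoˡ-≤ 2 (*-monoʳ-≤ 2 (m≤m+n (w * 4 + j) l)) ⟩
      2 * (w * 4 + j + l) + 2        ≡⟨ cong (λ x → 2 * x + 2) (trans (sym hits′) hits) ⟩
      2 * (j * suc (Q * 4) + r) + 2  ∎))
      where
      open ≤-Reasoning
      W≤w : W ≤ w
      W≤w = ≮⇒≥ w≮W
      regroup : ∀ W j → suc (W * 8 + suc (2 * j)) ≡ 2 * (W * 4 + j) + 2
      regroup = solve-∀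
      double : ∀ j Q → 2 * (suc j * Q) ≡ (2 + 2 * j) * Q
      double = solve-∀
      t≤1+2j : t < suc (suc (2 * j))
      t≤1+2j = *-cancelʳ-< Q t (2 + 2 * j) (begin-strict
        t * Q                ≡⟨ *-comm t Q ⟩
        Q * t                ≡⟨ Q*t≡2*W ⟩
        2 * W                ≤⟨ *-monoʳ-≤ 2 W≤w ⟩
        2 * w                <⟨ *-monoʳ-< 2 (m*n+o<p*n (n<1+n j) r/4<Q) ⟩
        2 * (suc j * Q)      ≡⟨ double j Q ⟩
        (2 + 2 * j) * Q      ∎)

  scheme : MagnitudeScheme W (Q * 4) t
  scheme = record { base = base ; α = 1 ; β = 2 ; bounded = bounded ; onto = onto }

module SchemeByEighths (W R τ : ℕ) .{{_ : NonZero R}} (R*τ≡W : R * τ ≡ W) where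

  u : ℕ
  u = suc R

  base : ℕ → ℕ
  base w = w % R + 4 * (w / R) * u

  offset-u-2u : ∀ l → offset u (2 * u) l ≡ l * u
  offset-u-2u l = begin
    l % 2 * u + l / 2 * (2 * u)  ≡⟨ factor (l % 2) (l / 2) u ⟩
    (l % 2 + l / 2 * 2) * u      ≡⟨ cong (_* u) (m≡m%n+[m/n]*n l 2) ⟨
    l * u                        ∎
    where
    open ≡-Reasoning
    factor : ∀ x y u → x * u + y * (2 * u) ≡ (x + y * 2) * u
    factor = solve-∀

  V≡2*[4τu] : W * 8 + τ * 8 ≡ 2 * (4 * τ * u)
  V≡2*[4τu] = trans (cong (λ x → x * 8 + τ * 8) (sym R*τ≡W)) (expand R τ)
    where
    expand : ∀ R τ → R * τ * 8 + τ * 8 ≡ 2 * (4 * τ * suc R)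
    expand = solve-∀

  bounded : ∀ {w l} → w < W → l < 4 → 2 * suc (base w + offset u (2 * u) l) ≤ W * 8 + τ * 8
  bounded {w} {l} w<W l<4 = begin
    2 * suc (w % R + 4 * q * u + offset u (2 * u) l)  ≡⟨ cong (λ x → 2 * suc (w % R + 4 * q * u + x)) (offset-u-2u l) ⟩
    2 * suc (w % R + 4 * q * u + l * u)               ≤⟨ *-monoʳ-≤ 2 below ⟩
    2 * (4 * suc q * u)                               ≤⟨ *-monoʳ-≤ 2 (*-monoˡ-≤ u (*-monoʳ-≤ 4 q<τ)) ⟩
    2 * (4 * τ * u)                                   ≡⟨ V≡2*[4τu] ⟨
    W * 8 + τ * 8                                     ∎
    where
    open ≤-Reasoning
    q : ℕ
    q = w / R
    q<τ : q < τ
    q<τ = m<n*o⇒m/o<n (subst (w <_) (trans (sym R*τ≡W) (*-comm R τ)) w<W)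
    expand : ∀ q R → 4 * suc q * suc R ≡ suc (R + 4 * q * suc R + 3 * suc R)
    expand = solve-∀
    below : suc (w % R + 4 * q * u + l * u) ≤ 4 * suc q * u
    below = begin
      suc (w % R + 4 * q * u + l * u)  ≤⟨ +-mono-≤ (+-monoˡ-≤ (4 * q * u) (m%n<n w R)) (*-monoˡ-≤ u (≤-pred l<4)) ⟩
      R + 4 * q * u + 3 * u            ≤⟨ n≤1+n _ ⟩
      suc (R + 4 * q * u + 3 * u)      ≡⟨ expand q R ⟨
      4 * suc q * u                    ∎

  onto : ∀ j {r} → r < R → 2 * (j * u + r) + 2 ≤ W * 8 + τ * 8 →
         ∃[ w ] ∃[ l ] (w < W × l < 4 × base w + offset u (2 * u) l ≡ j * u + r)
  onto j {r} r<R bound = w , l , w<W , m%n<n j 4 , hits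
    where
    open ≤-Reasoning
    j<4τ : j < τ * 4
    j<4τ with j <? τ * 4
    ... | yes j<4τ = j<4τ
    ... | no j≮4τ = contradiction bound (<⇒≱ (begin-strict
      W * 8 + τ * 8      ≡⟨ V≡2*[4τu] ⟩
      2 * (4 * τ * u)    ≡⟨ cong (λ x → 2 * (x * u)) (*-comm 4 τ) ⟩
      2 * (τ * 4 * u)    ≤⟨ *-monoʳ-≤ 2 (*-monoˡ-≤ u (≮⇒≥ j≮4τ)) ⟩
      2 * (j * u)        ≤⟨ *-monoʳ-≤ 2 (m≤m+n (j * u) r) ⟩
      2 * (j * u + r)    <⟨ m<m+n (2 * (j * u + r)) (s≤s z≤n) ⟩
      2 * (j * u + r) + 2 ∎))
    l : ℕ
    l = j % 4
    w : ℕ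
    w = j / 4 * R + r
    w<W : w < W
    w<W = begin-strict
      j / 4 * R + r  <⟨ m*n+o<p*n (m<n*o⇒m/o<n {n = τ} {o = 4} j<4τ) r<R ⟩
      τ * R          ≡⟨ trans (*-comm τ R) R*τ≡W ⟩
      W              ∎
    regroup : ∀ r x l u → r + 4 * x * u + l * u ≡ (l + x * 4) * u + r
    regroup = solve-∀
    hits : base w + offset u (2 * u) l ≡ j * u + r
    hits = begin-equality
      w % R + 4 * (w / R) * u + offset u (2 * u) l  ≡⟨ cong₂ (λ x y → x + 4 * y * u + offset u (2 * u) l) ([m*n+o]%n≡o (j / 4) r<R) ([m*n+o]/n≡m (j / 4) r<R) ⟩
      r + 4 * (j / 4) * u + offset u (2 * u) l      ≡⟨ cong (λ x → r + 4 * (j / 4) * u + x) (offset-u-2u l) ⟩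
      r + 4 * (j / 4) * u + l * u                   ≡⟨ regroup r (j / 4) l u ⟩
      (l + j / 4 * 4) * u + r                       ≡⟨ cong (λ x → x * u + r) (m≡m%n+[m/n]*n j 4) ⟨
      j * u + r                                     ∎

  scheme : MagnitudeScheme W R (τ * 8)
  scheme = record { base = base ; α = u ; β = 2 * u ; bounded = bounded ; onto = onto }

module SchemeByHalves (W R′ t′ : ℕ) .{{_ : NonZero R′}} (R′*t′≡W : R′ * t′ ≡ W) where

  u : ℕ
  u = suc (R′ * 2)

  base : ℕ → ℕ
  base w = 2 * (w % R′) + 2 * (w / R′) * u

  offset≤1+u : ∀ l → l < 4 → offset 1 u l ≤ 1 + u
  offset≤1+u l l<4 = +-mono-≤ (≤-trans (≤-reflexive (*-identityʳ (l % 2))) (<⇒≤pred (m%n<n l 2)))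
                              (≤-trans (*-monoˡ-≤ u (<⇒≤pred (m<n*o⇒m/o<n {n = 2} {o = 2} l<4))) (≤-reflexive (*-identityˡ u)))

  V≡2*[2t′u] : W * 8 + t′ * 4 ≡ 2 * (2 * t′ * u)
  V≡2*[2t′u] = trans (cong (λ x → x * 8 + t′ * 4) (sym R′*t′≡W)) (expand R′ t′)
    where
    expand : ∀ R′ t′ → R′ * t′ * 8 + t′ * 4 ≡ 2 * (2 * t′ * suc (R′ * 2))
    expand = solve-∀

  bounded : ∀ {w l} → w < W → l < 4 → 2 * suc (base w + offset 1 u l) ≤ W * 8 + t′ * 4
  bounded {w} {l} w<W l<4 = begin
    2 * suc (2 * ρ + 2 * q * u + offset 1 u l)  ≤⟨ *-monoʳ-≤ 2 below ⟩
    2 * (2 * suc q * u)                         ≤⟨ *-monoʳ-≤ 2 (*-monoˡ-≤ u (*-monoʳ-≤ 2 q<t′)) ⟩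
    2 * (2 * t′ * u)                            ≡⟨ V≡2*[2t′u] ⟨
    W * 8 + t′ * 4                              ∎
    where
    open ≤-Reasoning
    q : ℕ
    q = w / R′
    ρ : ℕ
    ρ = w % R′
    q<t′ : q < t′
    q<t′ = m<n*o⇒m/o<n (subst (w <_) (trans (sym R′*t′≡W) (*-comm R′ t′)) w<W)
    regroup : ∀ ρ q u → suc (2 * ρ + 2 * q * u + (1 + u)) ≡ 2 * suc ρ + 2 * q * u + u
    regroup = solve-∀
    expand : ∀ q R′ → 2 * suc q * suc (R′ * 2) ≡ suc (R′ * 2 + 2 * q * suc (R′ * 2) + suc (R′ * 2))
    expand = solve-∀
    below : suc (2 * ρ + 2 * q * u + offset 1 u l) ≤ 2 * suc q * u
    below = begin
      suc (2 * ρ + 2 * q * u + offset 1 u l)  ≤⟨ s≤s (+-monoʳ-≤ (2 * ρ + 2 * q * u) (offset≤1+u l l<4)) ⟩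
      suc (2 * ρ + 2 * q * u + (1 + u))       ≡⟨ regroup ρ q u ⟩
      2 * suc ρ + 2 * q * u + u               ≤⟨ +-monoˡ-≤ u (+-monoˡ-≤ (2 * q * u) (subst (2 * suc ρ ≤_) (*-comm 2 R′) (*-monoʳ-≤ 2 (m%n<n w R′)))) ⟩
      R′ * 2 + 2 * q * u + u                  ≤⟨ n≤1+n _ ⟩
      suc (R′ * 2 + 2 * q * u + u)            ≡⟨ expand q R′ ⟨
      2 * suc q * u                           ∎

  onto : ∀ j {r} → r < R′ * 2 → 2 * (j * u + r) + 2 ≤ W * 8 + t′ * 4 →
         ∃[ w ] ∃[ l ] (w < W × l < 4 × base w + offset 1 u l ≡ j * u + r)
  onto j {r} r<R bound = w , l , w<W , l<4 , hits
    where
    open ≤-Reasoning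
    j<2t′ : j < t′ * 2
    j<2t′ with j <? t′ * 2
    ... | yes j<2t′ = j<2t′
    ... | no j≮2t′ = contradiction bound (<⇒≱ (begin-strict
      W * 8 + t′ * 4      ≡⟨ V≡2*[2t′u] ⟩
      2 * (2 * t′ * u)    ≡⟨ cong (λ x → 2 * (x * u)) (*-comm 2 t′) ⟩
      2 * (t′ * 2 * u)    ≤⟨ *-monoʳ-≤ 2 (*-monoˡ-≤ u (≮⇒≥ j≮2t′)) ⟩
      2 * (j * u)         ≤⟨ *-monoʳ-≤ 2 (m≤m+n (j * u) r) ⟩
      2 * (j * u + r)     <⟨ m<m+n (2 * (j * u + r)) (s≤s z≤n) ⟩
      2 * (j * u + r) + 2 ∎))
    l : ℕ
    l = j % 2 * 2 + r % 2
    l<4 : l < 4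
    l<4 = m*n+o<p*n (m%n<n j 2) (m%n<n r 2)
    r/2<R′ : r / 2 < R′
    r/2<R′ = m<n*o⇒m/o<n r<R
    w : ℕ
    w = j / 2 * R′ + r / 2
    w<W : w < W
    w<W = begin-strict
      j / 2 * R′ + r / 2  <⟨ m*n+o<p*n (m<n*o⇒m/o<n {n = t′} {o = 2} j<2t′) r/2<R′ ⟩
      t′ * R′             ≡⟨ trans (*-comm t′ R′) R′*t′≡W ⟩
      W                   ∎
    regroup : ∀ x y u e f → 2 * x + 2 * y * u + (f * 1 + e * u) ≡ (e + y * 2) * u + (f + x * 2)
    regroup = solve-∀
    hits : base w + offset 1 u l ≡ j * u + r
    hits = begin-equality
      2 * (w % R′) + 2 * (w / R′) * u + offset 1 u l
        ≡⟨ cong₂ (λ x y → 2 * x + 2 * y * u + offset 1 u l) ([m*n+o]%n≡o (j / 2) r/2<R′) ([m*n+o]/n≡m (j / 2) r/2<R′) ⟩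
      2 * (r / 2) + 2 * (j / 2) * u + (l % 2 * 1 + l / 2 * u)
        ≡⟨ cong₂ (λ x y → 2 * (r / 2) + 2 * (j / 2) * u + (x * 1 + y * u)) ([m*n+o]%n≡o (j % 2) (m%n<n r 2)) ([m*n+o]/n≡m (j % 2) (m%n<n r 2)) ⟩
      2 * (r / 2) + 2 * (j / 2) * u + (r % 2 * 1 + j % 2 * u)
        ≡⟨ regroup (r / 2) (j / 2) u (j % 2) (r % 2) ⟩
      (j % 2 + j / 2 * 2) * u + (r % 2 + r / 2 * 2)
        ≡⟨ cong₂ (λ x y → x * u + y) (m≡m%n+[m/n]*n j 2) (m≡m%n+[m/n]*n r 2) ⟨
      j * u + r ∎

  scheme : MagnitudeScheme W (R′ * 2) (t′ * 4)
  scheme = record { base = base ; α = 1 ; β = u ; bounded = bounded ; onto = onto }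

record DyadicSplit (e R t W : ℕ) : Set where
  field
    i j R′ t′ : ℕ
    i+j≡e     : i + j ≡ e
    R≡2^i*R′  : R ≡ 2 ^ i * R′
    t≡2^j*t′  : t ≡ 2 ^ j * t′
    R′*t′≡W   : R′ * t′ ≡ W

dyadicSplit : ∀ e {R t W} → R * t ≡ 2 ^ e * W → DyadicSplit e R t W
dyadicSplit zero {R} {t} {W} R*t≡W = record
  { i = 0 ; j = 0 ; R′ = R ; t′ = t ; i+j≡e = refl
  ; R≡2^i*R′ = sym (+-identityʳ R) ; t≡2^j*t′ = sym (+-identityʳ t)
  ; R′*t′≡W = trans R*t≡W (+-identityʳ W) }
dyadicSplit (suc e) {R} {t} {W} R*t≡2X
  with euclidsLemma R t prime[2] (divides (2 ^ e * W) (trans R*t≡2X (trans (*-assoc 2 (2 ^ e) W) (*-comm 2 (2 ^ e * W)))))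
... | inj₁ (divides R₁ R≡R₁*2) = record
  { i = suc i ; j = j ; R′ = R′ ; t′ = t′ ; i+j≡e = cong suc i+j≡e ; t≡2^j*t′ = t≡2^j*t′ ; R′*t′≡W = R′*t′≡W
  ; R≡2^i*R′ = trans R≡R₁*2 (trans (*-comm R₁ 2) (trans (cong (2 *_) R≡2^i*R′) (sym (*-assoc 2 (2 ^ i) R′)))) }
  where
  split : DyadicSplit e R₁ t W
  split = dyadicSplit e {R₁} {t} {W} (*-cancelˡ-≡ (R₁ * t) (2 ^ e * W) 2 (begin
    2 * (R₁ * t)    ≡⟨ *-assoc 2 R₁ t ⟨
    2 * R₁ * t      ≡⟨ cong (_* t) (trans (*-comm 2 R₁) (sym R≡R₁*2)) ⟩
    R * t           ≡⟨ R*t≡2X ⟩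
    2 ^ suc e * W   ≡⟨ *-assoc 2 (2 ^ e) W ⟩
    2 * (2 ^ e * W) ∎))
    where open ≡-Reasoning
  open DyadicSplit split
... | inj₂ (divides t₁ t≡t₁*2) = record
  { i = i ; j = suc j ; R′ = R′ ; t′ = t′ ; R≡2^i*R′ = R≡2^i*R′ ; R′*t′≡W = R′*t′≡W ; i+j≡e = trans (+-suc i j) (cong suc i+j≡e)
  ; t≡2^j*t′ = trans t≡t₁*2 (trans (*-comm t₁ 2) (trans (cong (2 *_) t≡2^j*t′) (sym (*-assoc 2 (2 ^ j) t′)))) }
  where
  split : DyadicSplit e R t₁ W
  split = dyadicSplit e {R} {t₁} {W} (*-cancelˡ-≡ (R * t₁) (2 ^ e * W) 2 (begin
    2 * (R * t₁)    ≡⟨ x*[y*z]≡y*[x*z] 2 R t₁ ⟩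
    R * (2 * t₁)    ≡⟨ cong (R *_) (trans (*-comm 2 t₁) (sym t≡t₁*2)) ⟩
    R * t           ≡⟨ R*t≡2X ⟩
    2 ^ suc e * W   ≡⟨ *-assoc 2 (2 ^ e) W ⟩
    2 * (2 ^ e * W) ∎))
    where open ≡-Reasoning
  open DyadicSplit split

magnitudeScheme : ∀ W R t .{{_ : NonZero W}} → R * t ≡ 8 * W → MagnitudeScheme W R t
magnitudeScheme W R t R*t≡8W = fromSplit (dyadicSplit 3 R*t≡8W)
  where
  fromSplit : DyadicSplit 3 R t W → MagnitudeScheme W R t
  fromSplit record { i = i ; j = j ; R′ = R′ ; t′ = t′ ; i+j≡e = i+j≡3
                   ; R≡2^i*R′ = R≡2^i*R′ ; t≡2^j*t′ = t≡2^j*t′ ; R′*t′≡W = R′*t′≡W } =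
    cases i j i+j≡3 R≡2^i*R′ t≡2^j*t′
    where
    open ≡-Reasoning
    instance
      R′≢0 : NonZero R′
      R′≢0 = nonZero-factor R′ (>-nonZero⁻¹ W) (sym R′*t′≡W)
    cases : ∀ i j → i + j ≡ 3 → R ≡ 2 ^ i * R′ → t ≡ 2 ^ j * t′ → MagnitudeScheme W R t
    cases 0 .3 refl R≡R′ t≡8t′ =
      subst₂ (MagnitudeScheme W) (trans (sym (+-identityʳ R′)) (sym R≡R′)) (trans (*-comm t′ 8) (sym t≡8t′))
             (SchemeByEighths.scheme W R′ t′ R′*t′≡W)
    cases 1 .2 refl R≡2R′ t≡4t′ =
      subst₂ (MagnitudeScheme W) (trans (*-comm R′ 2) (sym R≡2R′)) (trans (*-comm t′ 4) (sym t≡4t′))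
             (SchemeByHalves.scheme W R′ t′ R′*t′≡W)
    cases 2 .1 refl R≡4R′ t≡2t′ =
      subst (λ R → MagnitudeScheme W R t) (trans (*-comm R′ 4) (sym R≡4R′))
            (SchemeByQuarters.scheme W R′ t (begin
              R′ * t          ≡⟨ cong (R′ *_) t≡2t′ ⟩
              R′ * (2 * t′)   ≡⟨ x*[y*z]≡y*[x*z] R′ 2 t′ ⟩
              2 * (R′ * t′)   ≡⟨ cong (2 *_) R′*t′≡W ⟩
              2 * W           ∎))
    cases 3 .0 refl R≡8R′ t≡t′ =
      subst₂ (MagnitudeScheme W) (trans (regroup R′) (sym R≡8R′)) (trans (sym (+-identityʳ t′)) (sym t≡t′))
             (SchemeByQuarters.scheme W (R′ * 2) t′ {{m*n≢0 R′ 2}} (begin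
               R′ * 2 * t′     ≡⟨ *-comm (R′ * 2) t′ ⟩
               t′ * (R′ * 2)   ≡⟨ x*[y*z]≡y*[x*z] t′ R′ 2 ⟩
               R′ * (t′ * 2)   ≡⟨ *-assoc R′ t′ 2 ⟨
               R′ * t′ * 2     ≡⟨ cong (_* 2) R′*t′≡W ⟩
               W * 2           ≡⟨ *-comm W 2 ⟩
               2 * W           ∎))
      where
      regroup : ∀ R′ → R′ * 2 * 4 ≡ 8 * R′
      regroup = solve-∀
    cases (suc (suc (suc (suc _)))) _ () _ _

module BlockArray (a b q d : ℕ) .{{_ : NonZero a}} .{{_ : NonZero b}} .{{_ : NonZero q}} .{{_ : NonZero d}}
                  (c≤d : q * 4 ≤ d) (base : ℕ → ℕ) (α β : ℕ) where

  open Cyclic d public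

  c : ℕ
  c = q * 4

  index : ℕ → ℕ → ℕ → ℕ → ℕ
  index x y g λ′ = ((x * b + y) * q + g) * d + λ′

  entry : ℕ → ℕ → ℕ → ℕ → ℕ → ℤ
  entry I x y g l = signed l (suc (base (index x y g (I ⊕ l % 2)) + offset α β l))

  cell : ℕ → ℕ → ℕ → ℕ → Maybe ℤ
  cell I x J y with J ⊖ I <? c
  ... | yes _ = just (entry I x y ((J ⊖ I) / 4) ((J ⊖ I) % 4))
  ... | no _  = nothing

  grid : ℕ → ℕ → Maybe ℤ
  grid r col = cell (r / a) (r % a) (col / b) (col % b)

  cell-filled : ∀ {I J} x y → J ⊖ I < c → cell I x J y ≡ just (entry I x y ((J ⊖ I) / 4) ((J ⊖ I) % 4))
  cell-filled {I} {J} x y filled with J ⊖ I <? c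
  ... | yes _ = refl
  ... | no unfilled = contradiction filled unfilled

  cell-empty : ∀ {I J} x y → c ≤ J ⊖ I → cell I x J y ≡ nothing
  cell-empty {I} {J} x y c≤L with J ⊖ I <? c
  ... | yes filled = contradiction filled (≤⇒≯ c≤L)
  ... | no _ = refl

  ∑-line : ∀ (φ : Maybe ℤ → ℤ) → φ nothing ≡ + 0 → (I J : ℕ → ℕ) → (∀ {L} → L < d → J L ⊖ I L ≡ L) → ∀ x y →
           ∑ d (λ L → φ (cell (I L) x (J L) y)) ≡ ∑ q (λ g → ∑ 4 (λ l → φ (just (entry (I (g * 4 + l)) x y g l))))
  ∑-line φ φ-empty I J J⊖I≡ x y = begin
    ∑ d Φ                                   ≡⟨ ∑-prefix Φ c≤d (λ L c≤L L<d → trans (cong φ (cell-empty x y (subst (c ≤_) (sym (J⊖I≡ L<d)) c≤L))) φ-empty) ⟩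
    ∑ (q * 4) Φ                             ≡⟨ ∑-* q 4 Φ ⟩
    ∑ q (λ g → ∑ 4 (λ l → Φ (g * 4 + l)))   ≡⟨ ∑-cong q (λ g g<q → ∑-cong 4 (λ l l<4 → cong φ (filled g<q l<4))) ⟩
    ∑ q (λ g → ∑ 4 (λ l → φ (just (entry (I (g * 4 + l)) x y g l)))) ∎
    where
    open ≡-Reasoning
    Φ : ℕ → ℤ
    Φ = λ L → φ (cell (I L) x (J L) y)
    filled : ∀ {g l} → g < q → l < 4 → cell (I (g * 4 + l)) x (J (g * 4 + l)) y ≡ just (entry (I (g * 4 + l)) x y g l)
    filled {g} {l} g<q l<4 = begin
      cell (I L) x (J L) y                                ≡⟨ cell-filled x y (subst (_< c) (sym J⊖I≡L) L<c) ⟩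
      just (entry (I L) x y ((J L ⊖ I L) / 4) ((J L ⊖ I L) % 4))  ≡⟨ cong (λ L′ → just (entry (I L) x y (L′ / 4) (L′ % 4))) J⊖I≡L ⟩
      just (entry (I L) x y (L / 4) (L % 4))              ≡⟨ cong₂ (λ g′ l′ → just (entry (I L) x y g′ l′)) ([m*n+o]/n≡m g l<4) ([m*n+o]%n≡o g l<4) ⟩
      just (entry (I L) x y g l)                          ∎
      where
      L : ℕ
      L = g * 4 + l
      L<c : L < c
      L<c = m*n+o<p*n g<q l<4
      J⊖I≡L : J L ⊖ I L ≡ L
      J⊖I≡L = J⊖I≡ (<-≤-trans L<c c≤d)

  ∑-row : ∀ (φ : Maybe ℤ → ℤ) → φ nothing ≡ + 0 → ∀ {r} → r < d * a →
          ∑ (d * b) (λ col → φ (grid r col)) ≡ ∑ b (λ y → ∑ q (λ g → ∑ 4 (λ l → φ (just (entry (r / a) (r % a) y g l)))))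
  ∑-row φ φ-empty {r} r<da = begin
    ∑ (d * b) (λ col → φ (grid r col))              ≡⟨ ∑-div-mod d b (λ J y → φ (cell I x J y)) ⟩
    ∑ d (λ J → ∑ b (λ y → φ (cell I x J y)))        ≡⟨ ∑-comm d b _ ⟩
    ∑ b (λ y → ∑ d (λ J → φ (cell I x J y)))        ≡⟨ ∑-cong b (λ y _ → ∑-rotate (λ J → φ (cell I x J y)) I<d) ⟩
    ∑ b (λ y → ∑ d (λ L → φ (cell I x (I ⊕ L) y)))  ≡⟨ ∑-cong b (λ y _ → ∑-line φ φ-empty (λ _ → I) (I ⊕_) ([I⊕L]⊖I≡L I<d) x y) ⟩
    ∑ b (λ y → ∑ q (λ g → ∑ 4 (λ l → φ (just (entry I x y g l))))) ∎
    where
    open ≡-Reasoning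
    I : ℕ
    I = r / a
    x : ℕ
    x = r % a
    I<d : I < d
    I<d = m<n*o⇒m/o<n r<da

  ∑-column : ∀ (φ : Maybe ℤ → ℤ) → φ nothing ≡ + 0 → ∀ {col} → col < d * b →
             ∑ (d * a) (λ r → φ (grid r col)) ≡
             ∑ a (λ x → ∑ q (λ g → ∑ 4 (λ l → φ (just (entry (col / b ⊖ (g * 4 + l)) x (col % b) g l)))))
  ∑-column φ φ-empty {col} col<db = begin
    ∑ (d * a) (λ r → φ (grid r col))                ≡⟨ ∑-div-mod d a (λ I x → φ (cell I x J y)) ⟩
    ∑ d (λ I → ∑ a (λ x → φ (cell I x J y)))        ≡⟨ ∑-comm d a _ ⟩
    ∑ a (λ x → ∑ d (λ I → φ (cell I x J y)))        ≡⟨ ∑-cong a (λ x _ → ∑-reflect (λ I → φ (cell I x J y)) J<d) ⟩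
    ∑ a (λ x → ∑ d (λ L → φ (cell (J ⊖ L) x J y)))  ≡⟨ ∑-cong a (λ x _ → ∑-line φ φ-empty (J ⊖_) (λ _ → J) (⊖-involutive J<d) x y) ⟩
    ∑ a (λ x → ∑ q (λ g → ∑ 4 (λ l → φ (just (entry (J ⊖ (g * 4 + l)) x y g l))))) ∎
    where
    open ≡-Reasoning
    J : ℕ
    J = col / b
    y : ℕ
    y = col % b
    J<d : J < d
    J<d = m<n*o⇒m/o<n col<db

  ∑-row-constant : ∀ (φ : Maybe ℤ → ℤ) → φ nothing ≡ + 0 → ∀ κ →
                   (∀ I x y g → ∑ 4 (λ l → φ (just (entry I x y g l))) ≡ + κ) →
                   ∀ {r} → r < d * a → ∑ (d * b) (λ col → φ (grid r col)) ≡ + (b * (q * κ))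
  ∑-row-constant φ φ-empty κ quadruple {r} r<da =
    trans (∑-row φ φ-empty r<da)
          (trans (∑-cong b (λ y _ → trans (∑-cong q (λ g _ → quadruple (r / a) (r % a) y g)) (∑-const q κ)))
                 (∑-const b (q * κ)))

  ∑-column-constant : ∀ (φ : Maybe ℤ → ℤ) → φ nothing ≡ + 0 → ∀ κ →
                      (∀ {J} x y {g} → J < d → g < q → ∑ 4 (λ l → φ (just (entry (J ⊖ (g * 4 + l)) x y g l))) ≡ + κ) →
                      ∀ {col} → col < d * b → ∑ (d * a) (λ r → φ (grid r col)) ≡ + (a * (q * κ))
  ∑-column-constant φ φ-empty κ quadruple {col} col<db =
    trans (∑-column φ φ-empty col<db)
          (trans (∑-cong a (λ x _ → trans (∑-cong q (λ g g<q → quadruple x (col % b) (m<n*o⇒m/o<n col<db) g<q)) (∑-const q κ)))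
                 (∑-const a (q * κ)))

  quadruple-filled : ∀ (I : ℕ → ℕ) x y g → ∑ 4 (λ l → + isFilled (just (entry (I l) x y g l))) ≡ + 4
  quadruple-filled I x y g = refl

  quadruple-positives : ∀ (I : ℕ → ℕ) x y g → ∑ 4 (λ l → + isPos (just (entry (I l) x y g l))) ≡ + 2
  quadruple-positives I x y g = refl

  quadruple-negatives : ∀ (I : ℕ → ℕ) x y g → ∑ 4 (λ l → + isNeg (just (entry (I l) x y g l))) ≡ + 2
  quadruple-negatives I x y g = refl

  row-quadruple-sum : ∀ I x y g → ∑ 4 (λ l → val (just (entry I x y g l))) ≡ + 0
  row-quadruple-sum I x y g = quadruple-sum B α β (+-comm (B 0) (B 1))
    where
    B : ℕ → ℕ
    B = λ l → base (index x y g (I ⊕ l % 2))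

  column-quadruple-sum : ∀ {J} x y {g} → J < d → g < q → ∑ 4 (λ l → val (just (entry (J ⊖ (g * 4 + l)) x y g l))) ≡ + 0
  column-quadruple-sum {J} x y {g} J<d g<q =
    quadruple-sum B α β (cong₂ _+_ (cong block (paired 0 (s≤s (s≤s z≤n))))
                                   (sym (cong block (paired 2 (s≤s (s≤s (s≤s (s≤s z≤n))))))))
    where
    block : ℕ → ℕ
    block = λ λ′ → base (index x y g λ′)
    B : ℕ → ℕ
    B = λ l → block ((J ⊖ (g * 4 + l)) ⊕ l % 2)
    paired : ∀ l → suc l < 4 → (J ⊖ (g * 4 + l)) ⊕ 0 ≡ (J ⊖ (g * 4 + suc l)) ⊕ 1
    paired l 1+l<4 = begin
      (J ⊖ L) ⊕ 0                ≡⟨ ⊕-identityʳ (⊖<d J L) ⟩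
      J ⊖ L                      ≡⟨ ⊖-suc J<d 1+L<d ⟨
      (J ⊖ suc L) ⊕ 1            ≡⟨ cong (λ L′ → (J ⊖ L′) ⊕ 1) (+-suc (g * 4) l) ⟨
      (J ⊖ (g * 4 + suc l)) ⊕ 1  ∎
      where
      open ≡-Reasoning
      L : ℕ
      L = g * 4 + l
      1+L<d : suc L < d
      1+L<d = subst (_< d) (+-suc (g * 4) l) (<-≤-trans (m*n+o<p*n g<q 1+l<4) c≤d)

  W : ℕ
  W = a * b * q * d

  index<W : ∀ {x y g λ′} → x < a → y < b → g < q → λ′ < d → index x y g λ′ < W
  index<W x<a y<b g<q λ′<d = m*n+o<p*n (m*n+o<p*n (m*n+o<p*n x<a y<b) g<q) λ′<d

  grid-entry : ∀ r col {e} → grid r col ≡ just e →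
               ∃[ w ] ∃[ l ] (w < W × l < 4 × e ≡ signed l (suc (base w + offset α β l)))
  grid-entry r col filled with col / b ⊖ r / a <? c
  ... | yes L<c = index (r % a) (col % b) ((col / b ⊖ r / a) / 4) (r / a ⊕ (col / b ⊖ r / a) % 4 % 2)
                , (col / b ⊖ r / a) % 4
                , index<W (m%n<n r a) (m%n<n col b) (m<n*o⇒m/o<n L<c) (⊕<d (r / a) ((col / b ⊖ r / a) % 4 % 2))
                , m%n<n (col / b ⊖ r / a) 4
                , sym (just-injective filled)

  grid-placed : ∀ {w l} → w < W → l < 4 →
                ∃[ r ] ∃[ col ] (r < d * a × col < d * b × grid r col ≡ just (signed l (suc (base w + offset α β l))))
  grid-placed {w} {l} w<W l<4 = I * a + x , J * b + y , m*n+o<p*n (⊖<d λ′ (l % 2)) x<a , m*n+o<p*n (⊕<d I L) (m%n<n _ b) , placed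
    where
    λ′ : ℕ
    λ′ = w % d
    g : ℕ
    g  = w / d % q
    y : ℕ
    y  = w / d / q % b
    x : ℕ
    x  = w / d / q / b
    x<a : x < a
    x<a = m<n*o⇒m/o<n (m<n*o⇒m/o<n (m<n*o⇒m/o<n w<W))
    decode : index x y g λ′ ≡ w
    decode = begin
      ((x * b + y) * q + g) * d + λ′  ≡⟨ cong (λ v → (v * q + g) * d + λ′) ([m/n]*n+m%n≡m (w / d / q) b) ⟩
      (w / d / q * q + g) * d + λ′    ≡⟨ cong (λ v → v * d + λ′) ([m/n]*n+m%n≡m (w / d) q) ⟩
      w / d * d + λ′                  ≡⟨ [m/n]*n+m%n≡m w d ⟩
      w                               ∎
      where open ≡-Reasoning
    I : ℕ
    I = λ′ ⊖ l % 2
    L : ℕ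
    L = g * 4 + l
    J : ℕ
    J = I ⊕ L
    L<c : L < c
    L<c = m*n+o<p*n (m%n<n (w / d) q) l<4
    J⊖I≡L : J ⊖ I ≡ L
    J⊖I≡L = [I⊕L]⊖I≡L (⊖<d λ′ (l % 2)) (<-≤-trans L<c c≤d)
    placed : grid (I * a + x) (J * b + y) ≡ just (signed l (suc (base w + offset α β l)))
    placed = begin
      grid (I * a + x) (J * b + y)                  ≡⟨ cong₂ (λ u v → cell u v ((J * b + y) / b) ((J * b + y) % b)) ([m*n+o]/n≡m I x<a) ([m*n+o]%n≡o I x<a) ⟩
      cell I x ((J * b + y) / b) ((J * b + y) % b)  ≡⟨ cong₂ (cell I x) ([m*n+o]/n≡m J (m%n<n _ b)) ([m*n+o]%n≡o J (m%n<n _ b)) ⟩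
      cell I x J y                                  ≡⟨ cell-filled x y (subst (_< c) (sym J⊖I≡L) L<c) ⟩
      just (entry I x y ((J ⊖ I) / 4) ((J ⊖ I) % 4)) ≡⟨ cong (λ L′ → just (entry I x y (L′ / 4) (L′ % 4))) J⊖I≡L ⟩
      just (entry I x y (L / 4) (L % 4))            ≡⟨ cong₂ (λ g′ l′ → just (entry I x y g′ l′)) ([m*n+o]/n≡m g l<4) ([m*n+o]%n≡o g l<4) ⟩
      just (entry I x y g l)                        ≡⟨ cong (λ λ″ → just (signed l (suc (base (index x y g λ″) + offset α β l)))) (⊖-⊕ (m%n<n w d) l%2≤d) ⟩
      just (signed l (suc (base (index x y g λ′) + offset α β l))) ≡⟨ cong (λ v → just (signed l (suc (base v + offset α β l)))) decode ⟩
      just (signed l (suc (base w + offset α β l))) ∎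
      where
      open ≡-Reasoning
      l%2≤d : l % 2 ≤ d
      l%2≤d = ≤-trans (<⇒≤pred (m%n<n l 2)) (>-nonZero⁻¹ d)

∣-zero : ∀ {V e} → e ≡ + 0 → + V ∣ℤ e
∣-zero {V} refl = V ∣0

∣-self : ∀ {V} e → ℤ.∣ e ∣ ≡ V → + V ∣ℤ e
∣-self e refl = ∣-refl

congruent-to-± : ∀ {V x y e} → (e ≡ + y ⊎ e ≡ ℤ.- + y) → (y ≡ x ⊎ x + y ≡ V) →
                 (+ V ∣ℤ e ℤ.- + x) ⊎ (+ V ∣ℤ e ℤ.- ℤ.- + x)
congruent-to-± {V} {x} (inj₁ refl) (inj₁ refl) = inj₁ (∣-zero (ℤ.+-inverseʳ (+ x)))
congruent-to-± {V} {x} {y} (inj₁ refl) (inj₂ x+y≡V) =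
  inj₂ (∣-self (+ y ℤ.- ℤ.- + x) (trans (cong (λ v → ℤ.∣ + y ℤ.+ v ∣) (ℤ.neg-involutive (+ x))) (trans (cong ℤ.∣_∣ (sym (ℤ.pos-+ y x))) (trans (+-comm y x) x+y≡V))))
congruent-to-± {V} {x} (inj₂ refl) (inj₁ refl) =
  inj₂ (∣-zero (trans (cong (ℤ._+_ (ℤ.- + x)) (ℤ.neg-involutive (+ x))) (ℤ.+-inverseˡ (+ x))))
congruent-to-± {V} {x} {y} (inj₂ refl) (inj₂ x+y≡V) =
  inj₁ (∣-self (ℤ.- + y ℤ.- + x) (trans (cong ℤ.∣_∣ (sym (ℤ.neg-distrib-+ (+ y) (+ x)))) (trans (ℤ.∣-i∣≡∣i∣ (+ y ℤ.+ + x)) (trans (cong ℤ.∣_∣ (sym (ℤ.pos-+ y x))) (trans (+-comm y x) x+y≡V)))))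

module Construction {m n s k : ℕ} (F : Factorisation m n s k) (t R : ℕ) (2ms≡Rt : 2 * m * s ≡ R * t) where

  open Factorisation F

  instance
    abqd≢0 : NonZero (a * b * q * d)
    abqd≢0 = m*n≢0 (a * b * q) d {{m*n≢0 (a * b) q {{m*n≢0 a b}}}}

  2ms≡8W : 2 * m * s ≡ a * b * q * d * 8
  2ms≡8W = trans (cong₂ (λ x y → 2 * x * y) m≡d*a s≡b*c) (regroup a b q d)
    where
    regroup : ∀ a b q d → 2 * (d * a) * (b * (q * 4)) ≡ a * b * q * d * 8
    regroup = solve-∀

  scheme : MagnitudeScheme (a * b * q * d) R t
  scheme = magnitudeScheme (a * b * q * d) R t (trans (sym 2ms≡Rt) (trans 2ms≡8W (*-comm (a * b * q * d) 8)))

  open MagnitudeScheme scheme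
  open BlockArray a b q d c≤d base α β

  V : ℕ
  V = 2 * m * s + t

  V≡8W+t : V ≡ W * 8 + t
  V≡8W+t = cong (_+ t) 2ms≡8W

  A : PFArray m n
  A i j = grid (toℕ i) (toℕ j)

  row< : ∀ (i : Fin m) → toℕ i < d * a
  row< i = subst (toℕ i <_) m≡d*a (toℕ<n i)

  column< : ∀ (j : Fin n) → toℕ j < d * b
  column< j = subst (toℕ j <_) n≡d*b (toℕ<n j)

  row-statistic : ∀ (φ : Maybe ℤ → ℤ) → φ nothing ≡ + 0 → ∀ κ →
                  (∀ I x y g → ∑ 4 (λ l → φ (just (entry I x y g l))) ≡ + κ) →
                  ∀ i → sumℤ n (λ j → φ (A i j)) ≡ + (b * (q * κ))
  row-statistic φ φ-empty κ quadruple i = begin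
    sumℤ n (λ j → φ (A i j))                   ≡⟨ sumℤ≡∑ n (λ col → φ (grid (toℕ i) col)) ⟩
    ∑ n (λ col → φ (grid (toℕ i) col))         ≡⟨ cong (λ N → ∑ N (λ col → φ (grid (toℕ i) col))) n≡d*b ⟩
    ∑ (d * b) (λ col → φ (grid (toℕ i) col))   ≡⟨ ∑-row-constant φ φ-empty κ quadruple (row< i) ⟩
    + (b * (q * κ))                            ∎
    where open ≡-Reasoning

  column-statistic : ∀ (φ : Maybe ℤ → ℤ) → φ nothing ≡ + 0 → ∀ κ →
                     (∀ {J} x y {g} → J < d → g < q → ∑ 4 (λ l → φ (just (entry (J ⊖ (g * 4 + l)) x y g l))) ≡ + κ) →
                     ∀ j → sumℤ m (λ i → φ (A i j)) ≡ + (a * (q * κ))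
  column-statistic φ φ-empty κ quadruple j = begin
    sumℤ m (λ i → φ (A i j))                   ≡⟨ sumℤ≡∑ m (λ r → φ (grid r (toℕ j))) ⟩
    ∑ m (λ r → φ (grid r (toℕ j)))             ≡⟨ cong (λ M → ∑ M (λ r → φ (grid r (toℕ j)))) m≡d*a ⟩
    ∑ (d * a) (λ r → φ (grid r (toℕ j)))       ≡⟨ ∑-column-constant φ φ-empty κ quadruple (column< j) ⟩
    + (a * (q * κ))                            ∎
    where open ≡-Reasoning

  entryRange : ∀ i j e → A i j ≡ just e → 1 ≤ ℤ.∣ e ∣ × ℤ.∣ e ∣ ≤ V / 2
  entryRange i j e A≡e =
    let w , l , w<W , l<4 , e≡ = grid-entry (toℕ i) (toℕ j) A≡e
        ∣e∣ = suc (base w + offset α β l)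
    in  subst (λ v → 1 ≤ v × v ≤ V / 2) (sym (trans (cong ℤ.∣_∣ e≡) (∣signed∣ l ∣e∣)))
              (s≤s z≤n , m≤n/2 (subst (2 * ∣e∣ ≤_) (sym V≡8W+t) (bounded w<W l<4)))

  V≡[1+R]*t : V ≡ suc R * t
  V≡[1+R]*t = trans (cong (_+ t) 2ms≡Rt) (+-comm (R * t) t)

  V∤xt⇒[1+R]∤x : ∀ x → ¬ (V ∣ x * t) → ¬ (suc R ∣ x)
  V∤xt⇒[1+R]∤x x V∤xt (divides p x≡p*u) = V∤xt (divides p (begin
    x * t              ≡⟨ cong (_* t) x≡p*u ⟩
    p * suc R * t      ≡⟨ *-assoc p (suc R) t ⟩
    p * (suc R * t)    ≡⟨ cong (p *_) V≡[1+R]*t ⟨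
    p * V              ∎))
    where open ≡-Reasoning

  label-of-magnitude : ∀ z → ¬ (suc R ∣ suc z) → 2 * suc z ≤ V →
                       ∃[ w ] ∃[ l ] (w < W × l < 4 × base w + offset α β l ≡ z)
  label-of-magnitude z ¬u∣1+z 2[1+z]≤V =
    let w , l , w<W , l<4 , hits = onto (z / suc R) ([1+n]∤[1+m]⇒m%[1+n]<n ¬u∣1+z) bound
    in  w , l , w<W , l<4 , trans hits ([m/n]*n+m%n≡m z (suc R))
    where
    bound : 2 * (z / suc R * suc R + z % suc R) + 2 ≤ W * 8 + t
    bound = begin
      2 * (z / suc R * suc R + z % suc R) + 2  ≡⟨ cong (λ v → 2 * v + 2) ([m/n]*n+m%n≡m z (suc R)) ⟩
      2 * z + 2                                ≡⟨ +-comm (2 * z) 2 ⟩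
      2 + 2 * z                                ≡⟨ *-distribˡ-+ 2 1 z ⟨
      2 * suc z                                ≤⟨ 2[1+z]≤V ⟩
      V                                        ≡⟨ V≡8W+t ⟩
      W * 8 + t                                ∎
      where open ≤-Reasoning

  label-placed : ∀ {w l} → w < W → l < 4 → ∃[ i ] ∃[ j ] (A i j ≡ just (signed l (suc (base w + offset α β l))))
  label-placed w<W l<4 =
    let r , col , r<da , col<db , placed = grid-placed w<W l<4
        r<m = subst (r <_) (sym m≡d*a) r<da
        col<n = subst (col <_) (sym n≡d*b) col<db
    in  fromℕ< r<m , fromℕ< col<n , trans (cong₂ grid (toℕ-fromℕ< r<m) (toℕ-fromℕ< col<n)) placed

  magnitude-placed : ∀ y → ¬ (suc R ∣ y) → 2 * y ≤ V → ∃[ i ] ∃[ j ] ∃[ l ] (A i j ≡ just (signed l y))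
  magnitude-placed zero    ¬u∣y _    = contradiction (suc R ∣0) ¬u∣y
  magnitude-placed (suc z) ¬u∣y 2y≤V =
    let w , l , w<W , l<4 , hits = label-of-magnitude z ¬u∣y 2y≤V
        i , j , placed = label-placed w<W l<4
    in  i , j , l , trans placed (cong (λ v → just (signed l (suc v))) hits)

  [1+R]∤representative : ∀ {x y} → ¬ (V ∣ x * t) → (y ≡ x ⊎ x + y ≡ V) → ¬ (suc R ∣ y)
  [1+R]∤representative {x} V∤xt (inj₁ refl) u∣y = V∤xt⇒[1+R]∤x x V∤xt u∣y
  [1+R]∤representative {x} {y} V∤xt (inj₂ x+y≡V) u∣y =
    V∤xt⇒[1+R]∤x x V∤xt (∣m+n∣m⇒∣n (subst (suc R ∣_) (trans (sym x+y≡V) (+-comm x y)) u∣V) u∣y)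
    where
    u∣V : suc R ∣ V
    u∣V = divides t (trans V≡[1+R]*t (*-comm (suc R) t))

  covers : ∀ x → x < V → ¬ (V ∣ x * t) →
           ∃[ i ] ∃[ j ] ∃[ e ] (A i j ≡ just e × ((+ V ∣ℤ e ℤ.- + x) ⊎ (+ V ∣ℤ e ℤ.- ℤ.- + x)))
  covers x x<V V∤xt =
    let y , 2y≤V , y≡±x = reflect-to-lower-half x<V
        i , j , l , A≡e = magnitude-placed y ([1+R]∤representative V∤xt y≡±x) 2y≤V
    in  i , j , signed l y , A≡e , congruent-to-± (signed-± l y) y≡±x

  row-count : ∀ (f : Maybe ℤ → ℕ) → f nothing ≡ 0 → ∀ κ →
              (∀ I x y g → ∑ 4 (λ l → + f (just (entry I x y g l))) ≡ + κ) →
              ∀ i → sumℕ n (λ j → f (A i j)) ≡ b * (q * κ)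
  row-count f f-empty κ quadruple i =
    ℤ.+-injective (trans (sumℕ≡sumℤ n _) (row-statistic (λ e → + f e) (cong +_ f-empty) κ quadruple i))

  column-count : ∀ (f : Maybe ℤ → ℕ) → f nothing ≡ 0 → ∀ κ →
                 (∀ {J} x y {g} → J < d → g < q → ∑ 4 (λ l → + f (just (entry (J ⊖ (g * 4 + l)) x y g l))) ≡ + κ) →
                 ∀ j → sumℕ m (λ i → f (A i j)) ≡ a * (q * κ)
  column-count f f-empty κ quadruple j =
    ℤ.+-injective (trans (sumℕ≡sumℤ m _) (column-statistic (λ e → + f e) (cong +_ f-empty) κ quadruple j))

  heffter : IntegerHeffter m n s k t A
  heffter = record
    { rowFill    = λ i → trans (row-count isFilled refl 4 (λ I → quadruple-filled (λ _ → I)) i) (sym s≡b*c)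
    ; colFill    = λ j → trans (column-count isFilled refl 4 (λ {J} x y {g} _ _ → quadruple-filled (λ l → J ⊖ (g * 4 + l)) x y g) j)
                               (sym k≡a*c)
    ; entryRange = entryRange
    ; covers     = covers
    ; rowSum     = λ i → trans (row-statistic val refl 0 row-quadruple-sum i) (cong +_ (*-zeroʳ-twice b q))
    ; colSum     = λ j → trans (column-statistic val refl 0 column-quadruple-sum j) (cong +_ (*-zeroʳ-twice a q))
    }
    where
    *-zeroʳ-twice : ∀ x y → x * (y * 0) ≡ 0
    *-zeroʳ-twice x y = trans (cong (x *_) (*-zeroʳ y)) (*-zeroʳ x)

  shiftable : Shiftable m n A
  shiftable = record
    { rowBal = λ i → trans (row-count isPos refl 2 (λ I → quadruple-positives (λ _ → I)) i)
                           (sym (row-count isNeg refl 2 (λ I → quadruple-negatives (λ _ → I)) i))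
    ; colBal = λ j → trans (column-count isPos refl 2 (λ {J} x y {g} _ _ → quadruple-positives (λ l → J ⊖ (g * 4 + l)) x y g) j)
                           (sym (column-count isNeg refl 2 (λ {J} x y {g} _ _ → quadruple-negatives (λ l → J ⊖ (g * 4 + l)) x y g) j))
    }

proposition3p5 : (m n s k : ℕ) → 4 ≤ s → s ≤ n → 4 ≤ k → k ≤ m →
    m * s ≡ n * k → s % 4 ≡ 0 → k % 4 ≡ 0 →
    (t : ℕ) → t ∣ 2 * m * s →
    ∃[ A ] (IntegerHeffter m n s k t A × Shiftable m n A)
proposition3p5 m n s k 4≤s s≤n 4≤k _ ms≡nk s%4≡0 k%4≡0 t (divides R 2ms≡R*t) =
  A , heffter , shiftable
  where
  F : Factorisation m n s k
  F = factorise {m} {n} 4≤s s≤n 4≤k ms≡nk (m%n≡0⇒n∣m s 4 s%4≡0) (m%n≡0⇒n∣m k 4 k%4≡0)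
  open Construction F t R 2ms≡R*t
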